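{- Let $\mathcal{A}=(Q,q_I,\delta,F)$ be a deterministic one-counter automaton with infinite run $(q_0,n_0)(q_1,n_1)\cdots$, and let $K_1,K_2,K_{inc}\in\mathbb{N}$ satisfy $K_1+K_2\le|Q|^3$, $K_{inc}\le|Q|$ and $(q_{i+K_2},n_{i+K_2})=(q_i,n_i+K_{inc})$ for all $i\ge K_1$. Suppose $K_{inc}>0$. Let $\beta_1,\beta_2\ge0$ be the smallest natural numbers such that $n_i\in[n_{K_1}-\beta_1,n_{K_1}+\beta_2]$ for every $i\in[K_1,K_1+K_2-1]$, let $\gamma$ be the greatest value among $\{n_0,\dots,n_{K_1-1}\}$, and let $L=1+\gamma+\lceil(\beta_1+\beta_2)/K_{inc}\rceil$. Define $P^1_\sim=\{(i,j)\in\{0,\dots,K_1+LK_2-1\}^2: n_i=n_j,\ i\le j\}$, $P^2_\sim=\{(i,j)\in\{0,\dots,K_1+LK_2-1\}^2: n_i=n_j+LK_{inc},\ j<i\}$ and $P_\sim=P^1_\sim\cup P^2_\sim$. Then for all $i,j\in\mathbb{N}$ with $j\ge i$, we have $n_i=n_j$ iff one of the following holds: (1) $(i,j)\in P^1_\sim$; (2) $i,j\ge K_1$, $(K_1+((i-K_1)\bmod LK_2),\ K_1+((j-K_1)\bmod LK_2))\in P_\sim$, and $j-i<LK_2$.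
   Context: A one-counter automaton is a tuple $\mathcal{A}=(Q,q_I,\delta,F)$ with $Q$ finite, $q_I\in Q$, $F\subseteq Q$, $\delta\subseteq Q\times\{\mathtt{inc},\mathtt{dec},\mathtt{ifzero}\}\times Q$. Configurations are $(q,n)\in Q\times\mathbb{N}$; $(q,n)\to(q',n')$ iff $(q,\mathtt{inc},q')\in\delta$ and $n'=n+1$, or $(q,\mathtt{dec},q')\in\delta$ and $n'=n-1\ge0$, or $(q,\mathtt{ifzero},q')\in\delta$ and $n=n'=0$. A run is a finite or infinite sequence of configurations starting at $(q_I,0)$ with consecutive ones related by $\to$. $\mathcal{A}$ is deterministic if for every state $q$: either exactly one transition leaves $q$ and it is labelled $\mathtt{inc}$, or exactly two leave $q$, one labelled $\mathtt{ifzero}$ and one $\mathtt{dec}$, or none leaves $q$; hence its infinite run, if any, is unique. -}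

module Defs where

open import Data.Nat using (ℕ; zero; suc; _+_; _*_; _∸_; _⊔_; _≤_; _<_; _/_; _%_)
open import Data.Bool using (Bool; true; false)
open import Data.Fin using (Fin)
open import Data.Product using (_×_; _,_; proj₁; proj₂; ∃-syntax)
open import Data.Sum using (_⊎_)
open import Data.List using (List; map; foldr; upTo)
open import Relation.Binary.PropositionalEquality using (_≡_)

data Op : Set where
  inc dec ifzero : Op

-- A one-counter automaton with state set Q = Fin k (k = |Q|).
-- The (finite) transition relation δ ⊆ Q × Op × Q is given by its
-- characteristic function.
record OCA (k : ℕ) : Set where
  field
    qI : Fin k
    δ  : Fin k → Op → Fin k → Bool
    F  : Fin k → Bool

Config : ℕ → Set
Config k = Fin k × ℕ

Deterministic : ∀ {k} → OCA k → Set
Deterministic {k} A =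
  (q : Fin k) →
    (∃[ q′ ] (δ q inc q′ ≡ true ×
       ((a : Op) (q″ : Fin k) → δ q a q″ ≡ true → (a ≡ inc × q″ ≡ q′))))
  ⊎ (∃[ q₁ ] ∃[ q₂ ] (δ q ifzero q₁ ≡ true × δ q dec q₂ ≡ true ×
       ((a : Op) (q″ : Fin k) → δ q a q″ ≡ true →
          ((a ≡ ifzero × q″ ≡ q₁) ⊎ (a ≡ dec × q″ ≡ q₂)))))
  ⊎ ((a : Op) (q″ : Fin k) → δ q a q″ ≡ false)
  where open OCA A

data Step {k} (A : OCA k) : Config k → Config k → Set where
  step-inc    : ∀ {q q′ n} → OCA.δ A q inc q′ ≡ true → Step A (q , n) (q′ , suc n)
  step-dec    : ∀ {q q′ n} → OCA.δ A q dec q′ ≡ true → Step A (q , suc n) (q′ , n)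
  step-ifzero : ∀ {q q′}   → OCA.δ A q ifzero q′ ≡ true → Step A (q , 0) (q′ , 0)

IsInfiniteRun : ∀ {k} → OCA k → (ℕ → Config k) → Set
IsInfiniteRun A r = (r 0 ≡ (OCA.qI A , 0)) × ((i : ℕ) → Step A (r i) (r (suc i)))

-- ⌈ a / b ⌉ for b > 0 (value at b = 0 is an irrelevant convention).
ceilDiv : ℕ → ℕ → ℕ
ceilDiv a zero    = 0
ceilDiv a (suc b) = (a + b) / suc b

-- m mod d for d > 0 (value at d = 0 is an irrelevant convention).
modℕ : ℕ → ℕ → ℕ
modℕ m zero    = m
modℕ m (suc d) = m % suc d

-- Maximum of f 0, …, f (K - 1)  (0 when K = 0).
maxBelow : ℕ → (ℕ → ℕ) → ℕ
maxBelow K f = foldr _⊔_ 0 (map f (upTo K))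

-- Only the counter values n i matter. From K₁ on they drift, n (i + K₂) = n i + Kinc, and on one
-- period they oscillate by at most β₁ + β₂. L is chosen so that the drift L Kinc over L periods
-- exceeds both this oscillation and every prefix value γ. Hence a position j ≥ K₁ + L K₂ carries a
-- value larger than every prefix value and every value at positions i ≥ K₁ with j - i ≥ L K₂. So
-- n i = n j forces either j < K₁ + L K₂, or K₁ ≤ i ≤ j < i + L K₂; in the latter case i and j lie
-- in the same or in adjacent blocks of length L K₂, and reducing modulo L K₂ turns n i = n j into
-- equality of the residues' values, respectively into a difference of exactly L Kinc.
module Submission where

open import Defs
open import Data.Nat using (ℕ; zero; suc; _+_; _*_; _∸_; _^_; _≤_; _<_)
open import Data.Product using (_×_; _,_; proj₁; proj₂)
open import Data.Sum using (_⊎_)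
open import Function.Bundles using (_⇔_)
open import Relation.Binary.PropositionalEquality using (_≡_)

open import Data.Nat using (_/_; _%_; NonZero; >-nonZero; z<s; s≤s; _<?_; _≤?_)
open import Data.Nat.Properties
open import Data.Nat.DivMod
open import Data.Nat.Divisibility using (n∣m*n; ∣-refl)
open import Data.List using (map; upTo)
open import Data.List.Properties using (foldr-preservesᵒ)
open import Data.List.Membership.Propositional.Properties using (∈-upTo⁺)
import Data.List.Relation.Unary.Any as Any
import Data.List.Relation.Unary.Any.Properties as Any
open import Data.Sum using (inj₁; inj₂; [_,_])
open import Function.Bundles using (Equivalence; mk⇔)
open import Function.Properties.Equivalence using () renaming (trans to ⇔-trans; sym to ⇔-sym)
open import Relation.Nullary using (yes; no; contradiction)
open import Relation.Binary.PropositionalEquality using (refl; sym; trans; cong; subst; subst₂; module ≡-Reasoning)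

modℕ≡% : ∀ m d .{{_ : NonZero d}} → modℕ m d ≡ m % d
modℕ≡% m (suc d) = refl

m≤⌈m/n⌉*n : ∀ m n .{{_ : NonZero n}} → m ≤ ceilDiv m n * n
m≤⌈m/n⌉*n m n@(suc b) = +-cancelʳ-≤ b m (q * n) (begin
  m + b                  ≡⟨ m≡m%n+[m/n]*n (m + b) n ⟩
  (m + b) % n + q * n    ≤⟨ +-monoˡ-≤ (q * n) (m<1+n⇒m≤n (m%n<n (m + b) n)) ⟩
  b + q * n              ≡⟨ +-comm b (q * n) ⟩
  q * n + b              ∎)
  where
  open ≤-Reasoning
  q = (m + b) / n

+-cancelʳ-≡-⇔ : ∀ {u v u′ v′} c → u ≡ u′ + c → v ≡ v′ + c → (u ≡ v) ⇔ (u′ ≡ v′)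
+-cancelʳ-≡-⇔ c refl refl = mk⇔ (+-cancelʳ-≡ c _ _) (cong (_+ c))

period≢0 : ∀ (g : ℕ → ℕ) i {p d} .{{_ : NonZero d}} → g (i + p) ≡ g i + d → NonZero p
period≢0 g i {zero}  {suc d} e = contradiction (trans (cong g (sym (+-identityʳ i))) e)
                                               (λ eq → <-irrefl eq (m<m+n (g i) z<s))
period≢0 g i {suc p}         e = _

≤-maxBelow : ∀ K f {i} → i < K → f i ≤ maxBelow K f
≤-maxBelow K f {i} i<K =
  foldr-preservesᵒ {P = f i ≤_} (λ x y → [ m≤n⇒m≤n⊔o y , m≤n⇒m≤o⊔n x ]) 0 (map f (upTo K))
    (inj₂ (Any.map⁺ (Any.map (λ { refl → ≤-refl }) (∈-upTo⁺ i<K))))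

module Drift (f : ℕ → ℕ) (p d : ℕ) (drift : ∀ t → f (t + p) ≡ f t + d) where

  drift-* : ∀ c t → f (t + c * p) ≡ f t + c * d
  drift-* zero    t = trans (cong f (+-identityʳ t)) (sym (+-identityʳ (f t)))
  drift-* (suc c) t = begin
    f (t + (p + c * p))  ≡⟨ cong f (sym (+-assoc t p (c * p))) ⟩
    f (t + p + c * p)    ≡⟨ drift-* c (t + p) ⟩
    f (t + p) + c * d    ≡⟨ cong (_+ c * d) (drift t) ⟩
    f t + d + c * d      ≡⟨ +-assoc (f t) d (c * d) ⟩
    f t + (d + c * d)    ∎
    where open ≡-Reasoning

  module _ .{{_ : NonZero p}} where

    f≡f[t%p]+[t/p]*d : ∀ t → f t ≡ f (t % p) + (t / p) * d
    f≡f[t%p]+[t/p]*d t = trans (cong f (m≡m%n+[m/n]*n t p)) (drift-* (t / p) (t % p))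

    c*d≤f : ∀ c {t} → c * p ≤ t → c * d ≤ f t
    c*d≤f c {t} c*p≤t = begin
      c * d                      ≤⟨ *-monoˡ-≤ d c≤t/p ⟩
      (t / p) * d                ≤⟨ m≤n+m ((t / p) * d) (f (t % p)) ⟩
      f (t % p) + (t / p) * d    ≡⟨ sym (f≡f[t%p]+[t/p]*d t) ⟩
      f t                        ∎
      where
      open ≤-Reasoning
      c≤t/p : c ≤ t / p
      c≤t/p = subst₂ _≤_ (m*n/n≡m c p) refl (/-monoˡ-≤ p c*p≤t)

    f<f-far : ∀ {w c} → (∀ s t → s < p → t < p → f s ≤ f t + w) → w < c * d →
              ∀ {x y} → x + c * p ≤ y → f x < f y
    f<f-far {w} {c} spread w<c*d {x} {y} x+c*p≤y = begin-strict
      f x                        ≡⟨ f≡f[t%p]+[t/p]*d x ⟩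
      f r + a * d                ≤⟨ +-monoˡ-≤ (a * d) (spread r s (m%n<n x p) (m%n<n y p)) ⟩
      f s + w + a * d            <⟨ +-monoˡ-< (a * d) (+-monoʳ-< (f s) w<c*d) ⟩
      f s + c * d + a * d        ≡⟨ +-assoc (f s) (c * d) (a * d) ⟩
      f s + (c * d + a * d)      ≡⟨ cong (f s +_) (sym (*-distribʳ-+ d c a)) ⟩
      f s + (c + a) * d          ≤⟨ +-monoʳ-≤ (f s) (*-monoˡ-≤ d c+a≤b) ⟩
      f s + b * d                ≡⟨ sym (f≡f[t%p]+[t/p]*d y) ⟩
      f y                        ∎
      where
      open ≤-Reasoning
      r = x % p
      s = y % p
      a = x / p
      b = y / p
      c+a≤b : c + a ≤ b
      c+a≤b = begin
        c + a                ≡⟨ +-comm c a ⟩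
        a + c                ≡⟨ cong (a +_) (sym (m*n/n≡m c p)) ⟩
        a + c * p / p        ≡⟨ sym (+-distrib-/-∣ʳ x (n∣m*n c)) ⟩
        (x + c * p) / p      ≤⟨ /-monoˡ-≤ p x+c*p≤y ⟩
        b                    ∎

    /-step : ∀ {x y} → x ≤ y → y < x + p → x / p ≡ y / p ⊎ y / p ≡ suc (x / p)
    /-step {x} {y} x≤y y<x+p with m≤n⇒m<n∨m≡n (/-monoˡ-≤ p x≤y)
    ... | inj₂ same = inj₁ same
    ... | inj₁ x/p<y/p = inj₂ (≤-antisym y/p≤1+x/p x/p<y/p)
      where
      open ≤-Reasoning
      y/p≤1+x/p : y / p ≤ suc (x / p)
      y/p≤1+x/p = begin
        y / p              ≤⟨ /-monoˡ-≤ p (<⇒≤ y<x+p) ⟩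
        (x + p) / p        ≡⟨ +-distrib-/-∣ʳ x ∣-refl ⟩
        x / p + p / p      ≡⟨ cong (x / p +_) (n/n≡1 p) ⟩
        x / p + 1          ≡⟨ +-comm (x / p) 1 ⟩
        suc (x / p)        ∎

    %-mono-≤-same-block : ∀ {x y} → x ≤ y → x / p ≡ y / p → x % p ≤ y % p
    %-mono-≤-same-block {x} {y} x≤y same = +-cancelʳ-≤ (x / p * p) (x % p) (y % p) (begin
      x % p + x / p * p    ≡⟨ sym (m≡m%n+[m/n]*n x p) ⟩
      x                    ≤⟨ x≤y ⟩
      y                    ≡⟨ m≡m%n+[m/n]*n y p ⟩
      y % p + y / p * p    ≡⟨ cong (λ q → y % p + q * p) (sym same) ⟩
      y % p + x / p * p    ∎)
      where open ≤-Reasoning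

    %-<-next-block : ∀ {x y} → y < x + p → y / p ≡ suc (x / p) → y % p < x % p
    %-<-next-block {x} {y} y<x+p next = +-cancelʳ-< (suc (x / p) * p) (y % p) (x % p) (begin-strict
      y % p + suc (x / p) * p    ≡⟨ cong (λ q → y % p + q * p) (sym next) ⟩
      y % p + y / p * p          ≡⟨ sym (m≡m%n+[m/n]*n y p) ⟩
      y                          <⟨ y<x+p ⟩
      x + p                      ≡⟨ cong (_+ p) (m≡m%n+[m/n]*n x p) ⟩
      x % p + x / p * p + p      ≡⟨ +-assoc (x % p) (x / p * p) p ⟩
      x % p + (x / p * p + p)    ≡⟨ cong (x % p +_) (+-comm (x / p * p) p) ⟩
      x % p + suc (x / p) * p    ∎)
      where open ≤-Reasoning

    same-block : ∀ {x y} → x / p ≡ y / p → (f x ≡ f y) ⇔ (f (x % p) ≡ f (y % p))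
    same-block {x} {y} same = +-cancelʳ-≡-⇔ (x / p * d) (f≡f[t%p]+[t/p]*d x) (begin
      f y                          ≡⟨ f≡f[t%p]+[t/p]*d y ⟩
      f (y % p) + y / p * d        ≡⟨ cong (λ q → f (y % p) + q * d) (sym same) ⟩
      f (y % p) + x / p * d        ∎)
      where open ≡-Reasoning

    next-block : ∀ {x y} → y / p ≡ suc (x / p) → (f x ≡ f y) ⇔ (f (x % p) ≡ f (y % p) + d)
    next-block {x} {y} next = +-cancelʳ-≡-⇔ (x / p * d) (f≡f[t%p]+[t/p]*d x) (begin
      f y                          ≡⟨ f≡f[t%p]+[t/p]*d y ⟩
      f (y % p) + y / p * d        ≡⟨ cong (λ q → f (y % p) + q * d) next ⟩
      f (y % p) + (d + x / p * d)  ≡⟨ sym (+-assoc (f (y % p)) d (x / p * d)) ⟩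
      f (y % p) + d + x / p * d    ∎)
      where open ≡-Reasoning

module UltimatelyDrifting
  (n : ℕ → ℕ) (K₁ K₂ Kinc β₁ β₂ : ℕ) .{{_ : NonZero Kinc}}
  (drift : ∀ i → K₁ ≤ i → n (i + K₂) ≡ n i + Kinc)
  (below : ∀ i → K₁ ≤ i → i < K₁ + K₂ → n K₁ ≤ n i + β₁)
  (above : ∀ i → K₁ ≤ i → i < K₁ + K₂ → n i ≤ n K₁ + β₂)
  where

  w γ L M D B : ℕ
  w = β₁ + β₂
  γ = maxBelow K₁ n
  L = 1 + γ + ceilDiv w Kinc
  M = L * K₂
  D = L * Kinc
  B = K₁ + M

  P¹ : ℕ → ℕ → Set
  P¹ i j = i < B × j < B × n i ≡ n j × i ≤ j
  P² : ℕ → ℕ → Set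
  P² i j = i < B × j < B × n i ≡ n j + L * Kinc × j < i
  P : ℕ → ℕ → Set
  P i j = P¹ i j ⊎ P² i j

  f : ℕ → ℕ
  f t = n (K₁ + t)

  n≡f[i∸K₁] : ∀ {i} → K₁ ≤ i → n i ≡ f (i ∸ K₁)
  n≡f[i∸K₁] K₁≤i = cong n (sym (m+[n∸m]≡n K₁≤i))

  f-drift : ∀ t → f (t + K₂) ≡ f t + Kinc
  f-drift t = trans (cong n (sym (+-assoc K₁ t K₂))) (drift (K₁ + t) (m≤m+n K₁ t))

  instance
    K₂≢0 : NonZero K₂
    K₂≢0 = period≢0 f 0 (f-drift 0)

    M≢0 : NonZero M
    M≢0 = m*n≢0 L K₂

  module Period = Drift f K₂ Kinc f-drift
  module Block  = Drift f M D (Period.drift-* L)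

  spread : ∀ s t → s < K₂ → t < K₂ → f s ≤ f t + w
  spread s t s<K₂ t<K₂ = begin
    n (K₁ + s)             ≤⟨ above (K₁ + s) (m≤m+n K₁ s) (+-monoʳ-< K₁ s<K₂) ⟩
    n K₁ + β₂              ≤⟨ +-monoˡ-≤ β₂ (below (K₁ + t) (m≤m+n K₁ t) (+-monoʳ-< K₁ t<K₂)) ⟩
    n (K₁ + t) + β₁ + β₂   ≡⟨ +-assoc (n (K₁ + t)) β₁ β₂ ⟩
    n (K₁ + t) + w         ∎
    where open ≤-Reasoning

  1+γ+w≤D : 1 + γ + w ≤ D
  1+γ+w≤D = begin
    1 + γ + w                                ≤⟨ +-mono-≤ (m≤m*n (1 + γ) Kinc) (m≤⌈m/n⌉*n w Kinc) ⟩
    (1 + γ) * Kinc + ceilDiv w Kinc * Kinc   ≡⟨ sym (*-distribʳ-+ Kinc (1 + γ) (ceilDiv w Kinc)) ⟩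
    D                                        ∎
    where open ≤-Reasoning

  γ<D : γ < D
  γ<D = m+n≤o⇒m≤o (1 + γ) 1+γ+w≤D

  w<D : w < D
  w<D = ≤-trans (s≤s (m≤n+m w γ)) 1+γ+w≤D

  prefix<late : ∀ {i j} → i < K₁ → B ≤ j → n i < n j
  prefix<late {i} {j} i<K₁ B≤j = begin-strict
    n i                ≤⟨ ≤-maxBelow K₁ n i<K₁ ⟩
    γ                  <⟨ γ<D ⟩
    D                  ≤⟨ Period.c*d≤f L (m+n≤o⇒m≤o∸n M (subst (_≤ j) (+-comm K₁ M) B≤j)) ⟩
    f (j ∸ K₁)         ≡⟨ sym (n≡f[i∸K₁] (m+n≤o⇒m≤o K₁ B≤j)) ⟩
    n j                ∎
    where open ≤-Reasoning

  late<far : ∀ {i j} → K₁ ≤ i → i + M ≤ j → n i < n j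
  late<far {i} {j} K₁≤i i+M≤j =
    subst₂ _<_ (sym (n≡f[i∸K₁] K₁≤i)) (sym (n≡f[i∸K₁] K₁≤j))
      (Period.f<f-far {c = L} spread w<D x+M≤y)
    where
    K₁≤j : K₁ ≤ j
    K₁≤j = ≤-trans K₁≤i (≤-trans (m≤m+n i M) i+M≤j)
    x+M≤y : i ∸ K₁ + M ≤ j ∸ K₁
    x+M≤y = subst (_≤ j ∸ K₁) (+-∸-comm M K₁≤i) (∸-monoˡ-≤ K₁ i+M≤j)

  P-ordered : ∀ {r s} → r < M → s < M → r ≤ s → P (K₁ + r) (K₁ + s) ⇔ (f r ≡ f s)
  P-ordered {r} {s} r<M s<M r≤s = mk⇔ to from
    where
    to : P (K₁ + r) (K₁ + s) → f r ≡ f s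
    to (inj₁ (_ , _ , e , _))   = e
    to (inj₂ (_ , _ , _ , s<r)) = contradiction r≤s (<⇒≱ (+-cancelˡ-< K₁ _ _ s<r))
    from : f r ≡ f s → P (K₁ + r) (K₁ + s)
    from e = inj₁ (+-monoʳ-< K₁ r<M , +-monoʳ-< K₁ s<M , e , +-monoʳ-≤ K₁ r≤s)

  P-reversed : ∀ {r s} → r < M → s < M → s < r → P (K₁ + r) (K₁ + s) ⇔ (f r ≡ f s + D)
  P-reversed {r} {s} r<M s<M s<r = mk⇔ to from
    where
    to : P (K₁ + r) (K₁ + s) → f r ≡ f s + D
    to (inj₁ (_ , _ , _ , r≤s)) = contradiction (+-cancelˡ-≤ K₁ _ _ r≤s) (<⇒≱ s<r)
    to (inj₂ (_ , _ , e , _))   = e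
    from : f r ≡ f s + D → P (K₁ + r) (K₁ + s)
    from e = inj₂ (+-monoʳ-< K₁ r<M , +-monoʳ-< K₁ s<M , e , +-monoʳ-< K₁ s<r)

  f≡f⇔P : ∀ {x y} → x ≤ y → y < x + M → (f x ≡ f y) ⇔ P (K₁ + x % M) (K₁ + y % M)
  f≡f⇔P {x} {y} x≤y y<x+M with Block./-step x≤y y<x+M
  ... | inj₁ same = ⇔-trans (Block.same-block same)
          (⇔-sym (P-ordered (m%n<n x M) (m%n<n y M) (Block.%-mono-≤-same-block x≤y same)))
  ... | inj₂ next = ⇔-trans (Block.next-block next)
          (⇔-sym (P-reversed (m%n<n x M) (m%n<n y M) (Block.%-<-next-block y<x+M next)))

  n≡n⇔P : ∀ {i j} → K₁ ≤ i → i ≤ j → j ∸ i < M →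
          (n i ≡ n j) ⇔ P (K₁ + modℕ (i ∸ K₁) M) (K₁ + modℕ (j ∸ K₁) M)
  n≡n⇔P {i} {j} K₁≤i i≤j j∸i<M
    rewrite modℕ≡% (i ∸ K₁) M {{M≢0}} | modℕ≡% (j ∸ K₁) M {{M≢0}}
          | n≡f[i∸K₁] K₁≤i | n≡f[i∸K₁] (≤-trans K₁≤i i≤j)
          = f≡f⇔P (∸-monoˡ-≤ K₁ i≤j) y<x+M
    where
    K₁≤j : K₁ ≤ j
    K₁≤j = ≤-trans K₁≤i i≤j
    j<i+M : j < i + M
    j<i+M = subst (_< i + M) (m+[n∸m]≡n i≤j) (+-monoʳ-< i j∸i<M)
    y<x+M : j ∸ K₁ < i ∸ K₁ + M
    y<x+M = subst (j ∸ K₁ <_) (+-∸-comm M K₁≤i) (∸-monoˡ-< j<i+M K₁≤j)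

  InSameOrAdjacentBlock : ℕ → ℕ → Set
  InSameOrAdjacentBlock i j =
    K₁ ≤ i × K₁ ≤ j × P (K₁ + modℕ (i ∸ K₁) M) (K₁ + modℕ (j ∸ K₁) M) × j ∸ i < M

  n≡n⇔ : ∀ i j → i ≤ j → (n i ≡ n j) ⇔ (P¹ i j ⊎ InSameOrAdjacentBlock i j)
  n≡n⇔ i j i≤j = mk⇔ to from
    where
    to : n i ≡ n j → P¹ i j ⊎ InSameOrAdjacentBlock i j
    to e with j <? B
    ... | yes j<B = inj₁ (≤-<-trans i≤j j<B , j<B , e , i≤j)
    ... | no j≮B with K₁ ≤? i
    ...   | no K₁≰i = contradiction e (<⇒≢ (prefix<late (≰⇒> K₁≰i) (≮⇒≥ j≮B)))
    ...   | yes K₁≤i with j ∸ i <? M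
    ...     | yes j∸i<M = inj₂ (K₁≤i , ≤-trans K₁≤i i≤j ,
                                Equivalence.to (n≡n⇔P K₁≤i i≤j j∸i<M) e , j∸i<M)
    ...     | no j∸i≮M = contradiction e (<⇒≢ (late<far K₁≤i i+M≤j))
      where
      i+M≤j : i + M ≤ j
      i+M≤j = subst (i + M ≤_) (m+[n∸m]≡n i≤j) (+-monoʳ-≤ i (≮⇒≥ j∸i≮M))
    from : P¹ i j ⊎ InSameOrAdjacentBlock i j → n i ≡ n j
    from (inj₁ (_ , _ , e , _))              = e
    from (inj₂ (K₁≤i , _ , p , j∸i<M)) = Equivalence.from (n≡n⇔P K₁≤i i≤j j∸i<M) p

lemma7 : ∀ {k : ℕ} (A : OCA k) → Deterministic A →
           (r : ℕ → Config k) → IsInfiniteRun A r →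
           (K₁ K₂ Kinc : ℕ) →
           K₁ + K₂ ≤ k ^ 3 →
           Kinc ≤ k →
           ((i : ℕ) → K₁ ≤ i → r (i + K₂) ≡ (proj₁ (r i) , proj₂ (r i) + Kinc)) →
           0 < Kinc →
           (β₁ β₂ : ℕ) →
           ((i : ℕ) → K₁ ≤ i → i < K₁ + K₂ → proj₂ (r K₁) ≤ proj₂ (r i) + β₁) →
           ((b : ℕ) → ((i : ℕ) → K₁ ≤ i → i < K₁ + K₂ → proj₂ (r K₁) ≤ proj₂ (r i) + b) → β₁ ≤ b) →
           ((i : ℕ) → K₁ ≤ i → i < K₁ + K₂ → proj₂ (r i) ≤ proj₂ (r K₁) + β₂) →
           ((b : ℕ) → ((i : ℕ) → K₁ ≤ i → i < K₁ + K₂ → proj₂ (r i) ≤ proj₂ (r K₁) + b) → β₂ ≤ b) →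
           let n : ℕ → ℕ
               n i = proj₂ (r i)
               γ = maxBelow K₁ n
               L = 1 + γ + ceilDiv (β₁ + β₂) Kinc
               B = K₁ + L * K₂
               P¹ : ℕ → ℕ → Set
               P¹ i j = i < B × j < B × n i ≡ n j × i ≤ j
               P² : ℕ → ℕ → Set
               P² i j = i < B × j < B × n i ≡ n j + L * Kinc × j < i
               P : ℕ → ℕ → Set
               P i j = P¹ i j ⊎ P² i j
           in (i j : ℕ) → i ≤ j →
              (n i ≡ n j) ⇔
                (P¹ i j ⊎
                 (K₁ ≤ i × K₁ ≤ j ×
                  P (K₁ + modℕ (i ∸ K₁) (L * K₂)) (K₁ + modℕ (j ∸ K₁) (L * K₂)) ×
                  j ∸ i < L * K₂))
lemma7 _ _ r _ K₁ K₂ Kinc _ _ periodic 0<Kinc β₁ β₂ below _ above _ =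
  UltimatelyDrifting.n≡n⇔ (λ i → proj₂ (r i)) K₁ K₂ Kinc β₁ β₂ {{>-nonZero 0<Kinc}}
    (λ i K₁≤i → cong proj₂ (periodic i K₁≤i)) below above
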